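{- Let $n\ge 2$, $1\le h(1)\le n$, and let $R=\mathbb{C}[x_1,\ldots,x_n,y_1,\ldots,y_n]/I$, where $I$ is generated by: $y_ky_{k'}$ ($k\ne k'$); $x_1y_k$ ($1\le k\le n$); $\left(\prod_{\ell=h(1)+1}^n(-x_\ell)\right)y_k-\prod_{\ell=2}^n(-x_\ell)$ ($1\le k\le n$); $\sum_{k=1}^ny_k-\prod_{\ell=2}^{h(1)}(x_1-x_\ell)$; and $e_i(x_1,\ldots,x_n)$ ($1\le i\le n$), with empty products equal to $1$. Let $B_1$ be the set of monomials $x_1^{i_1}\cdots x_n^{i_n}$ with $0\le i_j\le n-j$ not divisible by $\prod_{\ell=1}^{h(1)}x_\ell$. Then for every homogeneous polynomial $f\in\mathbb{C}[x_1,\ldots,x_n]$, the class of $f$ in $R$ is a $\mathbb{C}$-linear combination of the classes of elements of $B_1$.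
   Context: $R\cong H^*(\mathrm{Hess}(S,h);\mathbb{C})$ for $h=(h(1),n,\ldots,n)$ and $S$ regular semisimple (Abe–Horiguchi–Masuda), with $\deg x_i=2$, $\deg y_k=2(h(1)-1)$; it is known that $B_1$ together with the monomials $x_n^{\ell_1}\cdots x_2^{\ell_{n-1}}y_k$ ($0\le\ell_j\le n-1-j$, $1\le k\le n-1$, $x_n^{\ell_1}\cdots x_2^{\ell_{n-1}}$ not divisible by $\prod_{\ell=h(1)+1}^nx_\ell$) form a basis of $R$. -}

module Defs where

open import Level using (Level; _⊔_)
open import Data.Nat as ℕ using (ℕ; zero; suc; _∸_; _<_; _<ᵇ_)
open import Data.Bool using (if_then_else_)
open import Data.Fin using (Fin; toℕ)
open import Data.Vec as Vec using (Vec; lookup; tabulate; replicate; zipWith)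
open import Data.Vec.Properties using () renaming (≡-dec to vec≡-dec)
open import Data.List as List using (List; []; _∷_; _++_; concatMap; length; upTo)
import Data.List.Relation.Unary.All as All
open import Data.Product using (Σ; ∃; _×_; _,_; proj₁; proj₂)
open import Relation.Nullary using (¬_; does; Dec; yes; no)
open import Relation.Binary.PropositionalEquality using (_≡_; refl)
open import Algebra.Bundles using (CommutativeRing)

record Field (c ℓ : Level) : Set (Level.suc (c ⊔ ℓ)) where
  field
    commutativeRing : CommutativeRing c ℓ
  open CommutativeRing commutativeRing public
  field
    1≉0     : ¬ (1# ≈ 0#)
    inverse : ∀ x → ¬ (x ≈ 0#) → ∃ λ y → (x * y) ≈ 1#

module _ {c ℓ : Level} (K : Field c ℓ) where
  open Field K

  _×1 : ℕ → Carrier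
  zero ×1  = 0#
  suc n ×1 = 1# + (n ×1)

  CharZero : Set ℓ
  CharZero = ∀ n → ¬ ((suc n ×1) ≈ 0#)

-- A monomial is a pair of exponent vectors (x-exponents, y-exponents);
-- a polynomial is a finite formal sum (list) of terms c · monomial.

Mon : ℕ → Set
Mon n = Vec ℕ n × Vec ℕ n

monEq? : ∀ {n} (a b : Mon n) → Dec (a ≡ b)
monEq? (a , b) (a' , b') with vec≡-dec ℕ._≟_ a a' | vec≡-dec ℕ._≟_ b b'
... | yes refl | yes refl = yes refl
... | no p | _ = no λ { refl → p refl }
... | _ | no q = no λ { refl → q refl }

module Poly {c ℓ : Level} (K : Field c ℓ) (n : ℕ) where
  open Field K renaming (_+_ to _+K_; _*_ to _*K_; -_ to -K_; _≈_ to _≈K_)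

  Pol : Set c
  Pol = List (Carrier × Mon n)

  coeff : Pol → Mon n → Carrier
  coeff []            m = 0#
  coeff ((a , m') ∷ p) m = if does (monEq? m' m) then a +K coeff p m else coeff p m

  _≈P_ : Pol → Pol → Set ℓ
  p ≈P q = ∀ m → coeff p m ≈K coeff q m

  0P : Pol
  0P = []

  1P : Pol
  1P = (1# , (replicate n 0 , replicate n 0)) ∷ []

  _+P_ : Pol → Pol → Pol
  p +P q = p ++ q

  -P_ : Pol → Pol
  -P p = List.map (λ { (a , m) → (-K a , m) }) p

  _-P_ : Pol → Pol → Pol
  p -P q = p +P (-P q)

  mulMon : Mon n → Mon n → Mon n
  mulMon (a , b) (a' , b') = (zipWith ℕ._+_ a a' , zipWith ℕ._+_ b b')

  _*P_ : Pol → Pol → Pol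
  p *P q = concatMap (λ { (a , m) → List.map (λ { (a' , m') → (a *K a' , mulMon m m') }) q }) p

  sumP : List Pol → Pol
  sumP = List.foldr _+P_ 0P

  prodP : List Pol → Pol
  prodP = List.foldr _*P_ 1P

  -- exponent vector of the i-th variable, i counted from 1
  unit : ℕ → Vec ℕ n
  unit i = tabulate (λ k → if does (suc (toℕ k) ℕ.≟ i) then 1 else 0)

  x : ℕ → Pol
  x i = (1# , (unit i , replicate n 0)) ∷ []

  y : ℕ → Pol
  y i = (1# , (replicate n 0 , unit i)) ∷ []

  esym : ℕ → List Pol → Pol
  esym zero    _        = 1P
  esym (suc i) []       = 0P
  esym (suc i) (v ∷ vs) = (v *P esym i vs) +P esym (suc i) vs

  InIdeal : List Pol → Pol → Set (c ⊔ ℓ)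
  InIdeal gens p =
    ∃ λ (g : Fin (length gens) → Pol) →
      p ≈P sumP (List.map (λ i → g i *P List.lookup gens i) (List.allFin (length gens)))

  PolX : Set c
  PolX = List (Carrier × Vec ℕ n)

  liftX : PolX → Pol
  liftX = List.map (λ { (a , e) → (a , (e , replicate n 0)) })

  coeffX : PolX → Vec ℕ n → Carrier
  coeffX f e = coeff (liftX f) (e , replicate n 0)

  -- homogeneity (w.r.t. any fixed positive weight of the x's; all have deg x_i = 2)
  Homogeneous : PolX → Set ℓ
  Homogeneous f = ∃ λ d → ∀ e → ¬ (Vec.sum e ≡ d) → coeffX f e ≈K 0#

-- the list [a, a+1, ..., b] (empty if a > b)
range : ℕ → ℕ → List ℕ
range a b = List.map (a ℕ.+_) (upTo (suc b ∸ a))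

module Setup {c ℓ : Level} (K : Field c ℓ) (n h1 : ℕ) where
  open Field K using (Carrier)
  open Poly K n public

  gensYY : List Pol
  gensYY = concatMap (λ k → concatMap (λ k' →
             if does (k ℕ.≟ k') then [] else (y k *P y k') ∷ []) (range 1 n)) (range 1 n)

  gensXY : List Pol
  gensXY = List.map (λ k → x 1 *P y k) (range 1 n)

  gensProd : List Pol
  gensProd = List.map (λ k →
      (prodP (List.map (λ l → -P x l) (range (suc h1) n)) *P y k)
        -P prodP (List.map (λ l → -P x l) (range 2 n)))
    (range 1 n)

  genSum : Pol
  genSum = sumP (List.map y (range 1 n)) -P prodP (List.map (λ l → x 1 -P x l) (range 2 h1))

  gensE : List Pol
  gensE = List.map (λ i → esym i (List.map x (range 1 n))) (range 1 n)

  gens : List Pol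
  gens = gensYY ++ gensXY ++ gensProd ++ (genSum ∷ gensE)

  _≡I_ : Pol → Pol → Set (c ⊔ ℓ)
  p ≡I q = InIdeal gens (p -P q)

  MonDvd : Vec ℕ n → Vec ℕ n → Set
  MonDvd a b = ∀ k → lookup a k ℕ.≤ lookup b k

  prodFirst : Vec ℕ n
  prodFirst = tabulate (λ k → if toℕ k <ᵇ h1 then 1 else 0)

  InB1 : Vec ℕ n → Set
  InB1 e = (∀ k → lookup e k ℕ.≤ n ∸ suc (toℕ k)) × ¬ MonDvd prodFirst e

{-# OPTIONS --safe #-}
module Submission where

open import Defs
open import Level using (Level; _⊔_)
open import Data.Nat as ℕ using (ℕ; zero; suc; _∸_; _≤_; _<_; z≤n; s≤s)
import Data.Nat.Properties as ℕ
open import Data.Nat.Induction using (<-wellFounded)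
open import Induction.WellFounded using (Acc; acc)
open import Data.Bool using (if_then_else_)
import Data.Bool.Properties as Bool
open import Data.Fin as Fin using (Fin; zero; suc; toℕ)
import Data.Fin.Properties as Fin
open import Data.Vec as Vec using (Vec; []; _∷_; replicate; zipWith; lookup; tabulate)
import Data.Vec.Properties as Vec
open import Data.List as List using (List; []; _∷_; _++_; length; upTo; _ʳ++_)
import Data.List.Properties as List
open import Data.List.Relation.Unary.All as All using (All; []; _∷_)
import Data.List.Relation.Unary.All.Properties as All
open import Data.List.Relation.Unary.Any using (here; there; index)
open import Data.List.Relation.Unary.Any.Properties using (lookup-index)
open import Data.List.Membership.Propositional using (_∈_)
open import Data.List.Membership.Propositional.Properties using (∈-map⁺; ∈-++⁺ˡ; ∈-++⁺ʳ; ∈-upTo⁺)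
open import Data.Product using (∃; _×_; _,_; proj₁; proj₂)
open import Data.Sum using (_⊎_; inj₁; inj₂; [_,_])
open import Data.Empty using (⊥-elim)
open import Function using (_∘_)
open import Relation.Nullary using (¬_; does; Dec; yes; no; _×-dec_)
open import Relation.Nullary.Decidable using (dec-true; dec-false)
open import Function.Bundles using (Equivalence)
open import Relation.Binary.PropositionalEquality as ≡ using (_≡_; _≢_)
open import Algebra.Bundles using (CommutativeRing)
open import Algebra.Structures using (IsCommutativeRing)

-- Since e₁, …, eₙ ∈ I, moving variables across one at a time gives
-- h_k(x₁, …, x_{j+1}) ≡ (-1)ᵏ e_k(x_{j+2}, …, xₙ) for the complete homogeneous polynomials h_k, and the
-- right side is 0 for k = n - j.  The only monomial of h_{n-j}(x₁, …, x_{j+1}) with x_{j+1}-exponent n - j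
-- is x_{j+1}^{n-j}, so every monomial is congruent to monomials in which the exponent of x_{j+1} is at most
-- n - 1 - j; doing this for j = n - 1 down to 1 changes only lower variables, and for j = 0 it says x₁ⁿ ∈ I.
-- Next, x₁ yₖ ∈ I and Σₖ yₖ ≡ ∏_{l=2}^{h1} (x₁ - x_l) give x₁ ∏_{l=2}^{h1} (x₁ - x_l) ∈ I; expanding, a
-- monomial divisible by x₁ ⋯ x_{h1} is congruent to monomials with a larger exponent of x₁ and no larger
-- other exponents.  As the exponent of x₁ stays below n, this terminates in B₁.

zipWith-+-∸ : ∀ {k} (a b : Vec ℕ k) → a ≡ zipWith _∸_ (zipWith ℕ._+_ a b) b
zipWith-+-∸ []      []      = ≡.refl
zipWith-+-∸ (x ∷ a) (y ∷ b) = ≡.cong₂ _∷_ (≡.sym (ℕ.m+n∸n≡m x y)) (zipWith-+-∸ a b)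

lookup-ext : ∀ {A : Set} {k} {u v : Vec A k} → (∀ i → lookup u i ≡ lookup v i) → u ≡ v
lookup-ext {u = u} {v} u≗v = ≡.trans (≡.sym (Vec.tabulate∘lookup u))
                                     (≡.trans (Vec.tabulate-cong u≗v) (Vec.tabulate∘lookup v))

∸-suc : ∀ {j N} → j < N → N ∸ j ≡ suc (N ∸ suc j)
∸-suc {j} {suc N} (s≤s j≤N) = ℕ.+-∸-assoc 1 j≤N

map-+-upTo-suc : ∀ a d → List.map (a ℕ.+_) (upTo (suc d)) ≡ a ∷ List.map (suc a ℕ.+_) (upTo d)
map-+-upTo-suc a d = ≡.cong₂ _∷_ (ℕ.+-identityʳ a) (begin
  List.map (a ℕ.+_) (List.applyUpTo suc d)      ≡⟨ ≡.cong (List.map (a ℕ.+_)) (List.map-upTo suc d) ⟨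
  List.map (a ℕ.+_) (List.map suc (upTo d))     ≡⟨ List.map-∘ (upTo d) ⟨
  List.map (λ i → a ℕ.+ suc i) (upTo d)          ≡⟨ List.map-cong (ℕ.+-suc a) (upTo d) ⟩
  List.map (suc a ℕ.+_) (upTo d) ∎)
  where open ≡.≡-Reasoning

range-∷ : ∀ {j N} → j < N → range (suc j) N ≡ suc j ∷ range (suc (suc j)) N
range-∷ {j} {N} j<N = ≡.trans (≡.cong (λ d → List.map (suc j ℕ.+_) (upTo d)) (∸-suc j<N))
                               (map-+-upTo-suc (suc j) (N ∸ suc j))

range-[] : ∀ {j N} → N ≤ j → range (suc j) N ≡ []
range-[] {j} N≤j = ≡.cong (λ d → List.map (suc j ℕ.+_) (upTo d)) (ℕ.m≤n⇒m∸n≡0 N≤j)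

length-range : ∀ j N → length (range (suc j) N) ≡ N ∸ j
length-range j N = ≡.trans (List.length-map _ (upTo (N ∸ j))) (List.length-upTo (N ∸ j))

∈-range : ∀ {k N} → k < N → suc k ∈ range 1 N
∈-range k<N = ∈-map⁺ (1 ℕ.+_) (∈-upTo⁺ k<N)

module PolynomialRing {c ℓ : Level} (K : Field c ℓ) (n : ℕ) where
  open Field K hiding (isCommutativeRing) renaming (_+_ to _+K_; _*_ to _*K_; -_ to -K_; _≈_ to _≈K_)
  open Poly K n
  open import Relation.Binary.Reasoning.Setoid setoid
  open import Algebra.Properties.AbelianGroup +-abelianGroup using (⁻¹-∙-comm)
  open import Algebra.Properties.Group +-group using (ε⁻¹≈ε)
  open import Algebra.Properties.CommutativeSemigroup +-commutativeSemigroup using (x∙yz≈y∙xz)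

  Term : Set c
  Term = Carrier × Mon n

  mulMon-assoc : ∀ m₁ m₂ m₃ → mulMon (mulMon m₁ m₂) m₃ ≡ mulMon m₁ (mulMon m₂ m₃)
  mulMon-assoc (a , b) (a′ , b′) (a″ , b″) =
    ≡.cong₂ _,_ (Vec.zipWith-assoc ℕ.+-assoc a a′ a″) (Vec.zipWith-assoc ℕ.+-assoc b b′ b″)

  mulMon-identityˡ : ∀ m → mulMon (replicate n 0 , replicate n 0) m ≡ m
  mulMon-identityˡ (a , b) =
    ≡.cong₂ _,_ (Vec.zipWith-identityˡ ℕ.+-identityˡ a) (Vec.zipWith-identityˡ ℕ.+-identityˡ b)

  -- Wrapping ≈P in a record lets Agda infer the two polynomials being compared.
  infix 4 _≋_
  record _≋_ (p q : Pol) : Set ℓ where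
    constructor coeffwise
    field coeff-≈ : p ≈P q
  open _≋_ public

  ≋-refl : ∀ {p} → p ≋ p
  ≋-refl = coeffwise (λ _ → refl)

  ≋-sym : ∀ {p q} → p ≋ q → q ≋ p
  ≋-sym p≋q = coeffwise (λ m → sym (coeff-≈ p≋q m))

  ≋-trans : ∀ {p q r} → p ≋ q → q ≋ r → p ≋ r
  ≋-trans p≋q q≋r = coeffwise (λ m → trans (coeff-≈ p≋q m) (coeff-≈ q≋r m))

  ≡⇒≋ : ∀ {p q} → p ≡ q → p ≋ q
  ≡⇒≋ ≡.refl = ≋-refl

  coeff-++ : ∀ p q m → coeff (p ++ q) m ≈K coeff p m +K coeff q m
  coeff-++ [] q m = sym (+-identityˡ _)
  coeff-++ ((a , m′) ∷ p) q m with monEq? m′ m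
  ... | yes _ = trans (+-congˡ (coeff-++ p q m)) (sym (+-assoc _ _ _))
  ... | no _  = coeff-++ p q m

  coeff-neg : ∀ p m → coeff (-P p) m ≈K -K coeff p m
  coeff-neg [] m = sym ε⁻¹≈ε
  coeff-neg ((a , m′) ∷ p) m with monEq? m′ m
  ... | yes _ = trans (+-congˡ (coeff-neg p m)) (⁻¹-∙-comm a (coeff p m))
  ... | no _  = coeff-neg p m

  map-cong : ∀ {A : Set c} (f g : A → Term) →
             (∀ t → proj₁ (f t) ≈K proj₁ (g t)) → (∀ t → proj₂ (f t) ≡ proj₂ (g t)) →
             ∀ ts → List.map f ts ≋ List.map g ts
  map-cong f g f≈g f≡g ts = coeffwise (go ts)
    where
    go : ∀ ts → List.map f ts ≈P List.map g ts
    go [] m = refl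
    go (t ∷ ts) m with proj₂ (f t) | f≡g t
    ... | .(proj₂ (g t)) | ≡.refl with monEq? (proj₂ (g t)) m
    ...   | yes _ = +-cong (f≈g t) (go ts m)
    ...   | no _  = go ts m

  ∷-cong : ∀ t {p q} → p ≋ q → (t ∷ p) ≋ (t ∷ q)
  ∷-cong (a , m′) {p} {q} p≋q = coeffwise go
    where
    go : ∀ m → coeff ((a , m′) ∷ p) m ≈K coeff ((a , m′) ∷ q) m
    go m with monEq? m′ m
    ... | yes _ = +-congˡ (coeff-≈ p≋q m)
    ... | no _  = coeff-≈ p≋q m

  singleton-cong : ∀ {a b m m′} → a ≈K b → m ≡ m′ → ((a , m) ∷ []) ≋ ((b , m′) ∷ [])
  singleton-cong {a} {b} {m} a≈b ≡.refl = coeffwise go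
    where
    go : ∀ m′ → coeff ((a , m) ∷ []) m′ ≈K coeff ((b , m) ∷ []) m′
    go m′ with monEq? m m′
    ... | yes _ = +-congʳ a≈b
    ... | no _  = refl

  ++-cong : ∀ {p p′ q q′} → p ≋ p′ → q ≋ q′ → (p ++ q) ≋ (p′ ++ q′)
  ++-cong {p} {p′} {q} {q′} p≋ q≋ = coeffwise (λ m →
    trans (coeff-++ p q m) (trans (+-cong (coeff-≈ p≋ m) (coeff-≈ q≋ m)) (sym (coeff-++ p′ q′ m))))

  ++-comm : ∀ p q → (p ++ q) ≋ (q ++ p)
  ++-comm p q = coeffwise (λ m → trans (coeff-++ p q m) (trans (+-comm _ _) (sym (coeff-++ q p m))))

  ++-swap : ∀ p q r → (p ++ (q ++ r)) ≋ (q ++ (p ++ r))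
  ++-swap p q r = coeffwise (λ m → begin
    coeff (p ++ (q ++ r)) m                 ≈⟨ trans (coeff-++ p _ m) (+-congˡ (coeff-++ q r m)) ⟩
    coeff p m +K (coeff q m +K coeff r m)   ≈⟨ x∙yz≈y∙xz _ _ _ ⟩
    coeff q m +K (coeff p m +K coeff r m)   ≈⟨ sym (trans (coeff-++ q _ m) (+-congˡ (coeff-++ p r m))) ⟩
    coeff (q ++ (p ++ r)) m ∎)

  -P-cong : ∀ {p q} → p ≋ q → (-P p) ≋ (-P q)
  -P-cong {p} {q} p≋q = coeffwise (λ m →
    trans (coeff-neg p m) (trans (-‿cong (coeff-≈ p≋q m)) (sym (coeff-neg q m))))

  -P-inverseˡ : ∀ p → ((-P p) ++ p) ≋ []
  -P-inverseˡ p = coeffwise (λ m →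
    trans (coeff-++ (-P p) p m) (trans (+-congʳ (coeff-neg p m)) (-‿inverseˡ _)))

  -P-inverseʳ : ∀ p → (p ++ (-P p)) ≋ []
  -P-inverseʳ p = coeffwise (λ m →
    trans (coeff-++ p (-P p) m) (trans (+-congˡ (coeff-neg p m)) (-‿inverseʳ _)))

  _◃_ : Term → Pol → Pol
  (a , m₁) ◃ q = List.map (λ { (b , m₂) → (a *K b , mulMon m₁ m₂) }) q

  _▹_ : Pol → Term → Pol
  p ▹ (b , m₂) = List.map (λ { (a , m₁) → (a *K b , mulMon m₁ m₂) }) p

  ◃≋▹ : ∀ t q → (t ◃ q) ≋ (q ▹ t)
  ◃≋▹ (a , m₁) = map-cong _ _ (λ t → *-comm a (proj₁ t))
    (λ t → ≡.cong₂ _,_ (Vec.zipWith-comm ℕ.+-comm _ _) (Vec.zipWith-comm ℕ.+-comm _ _))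

  *P-zeroʳ : ∀ p → (p *P []) ≡ []
  *P-zeroʳ []      = ≡.refl
  *P-zeroʳ (t ∷ p) = *P-zeroʳ p

  *P-∷ʳ : ∀ p t q → (p *P (t ∷ q)) ≋ ((p ▹ t) ++ (p *P q))
  *P-∷ʳ []      t q = ≋-refl
  *P-∷ʳ (s ∷ p) t q =
    ∷-cong _ (≋-trans (++-cong (≋-refl {s ◃ q}) (*P-∷ʳ p t q)) (++-swap (s ◃ q) (p ▹ t) (p *P q)))

  _÷_ : Mon n → Mon n → Mon n
  (a , b) ÷ (a′ , b′) = (zipWith _∸_ a a′ , zipWith _∸_ b b′)

  mulMon-cancelʳ : ∀ {m₁ m₂ m} → mulMon m₁ m₂ ≡ m → m₁ ≡ m ÷ m₂
  mulMon-cancelʳ {a , b} {a′ , b′} ≡.refl = ≡.cong₂ _,_ (zipWith-+-∸ a a′) (zipWith-+-∸ b b′)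

  -- Multiplying by the monomial m₂ is injective, so p ▹ (b , m₂) has coefficient (coeff p m′) b at
  -- m′ m₂ and 0 at monomials that are not multiples of m₂; this gives the congruence ▹-cong.
  coeff-▹-multiple : ∀ p {b m′ m₂ m} → mulMon m′ m₂ ≡ m → coeff (p ▹ (b , m₂)) m ≈K coeff p m′ *K b
  coeff-▹-multiple [] {b} _ = sym (zeroˡ b)
  coeff-▹-multiple ((a , m₁) ∷ p) {b} {m′} {m₂} {m} e with monEq? (mulMon m₁ m₂) m | monEq? m₁ m′
  ... | yes _  | yes _      = trans (+-congˡ (coeff-▹-multiple p e)) (sym (distribʳ b a _))
  ... | yes e₁ | no m₁≢m′   = ⊥-elim (m₁≢m′ (≡.trans (mulMon-cancelʳ e₁) (≡.sym (mulMon-cancelʳ e))))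
  ... | no ne  | yes ≡.refl = ⊥-elim (ne e)
  ... | no _   | no _       = coeff-▹-multiple p e

  coeff-▹-nonmultiple : ∀ p {b m₂ m} → (∀ m′ → mulMon m′ m₂ ≢ m) → coeff (p ▹ (b , m₂)) m ≈K 0#
  coeff-▹-nonmultiple [] _ = refl
  coeff-▹-nonmultiple ((a , m₁) ∷ p) {b} {m₂} {m} ne with monEq? (mulMon m₁ m₂) m
  ... | yes e = ⊥-elim (ne m₁ e)
  ... | no _  = coeff-▹-nonmultiple p ne

  ▹-cong : ∀ {p p′} t → p ≋ p′ → (p ▹ t) ≋ (p′ ▹ t)
  ▹-cong {p} {p′} (b , m₂) p≋p′ = coeffwise go
    where
    go : ∀ m → coeff (p ▹ (b , m₂)) m ≈K coeff (p′ ▹ (b , m₂)) m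
    go m with monEq? (mulMon (m ÷ m₂) m₂) m
    ... | yes e = trans (coeff-▹-multiple p e)
                        (trans (*-congʳ (coeff-≈ p≋p′ _)) (sym (coeff-▹-multiple p′ e)))
    ... | no ne = trans (coeff-▹-nonmultiple p none) (sym (coeff-▹-nonmultiple p′ none))
      where
      none : ∀ m′ → mulMon m′ m₂ ≢ m
      none m′ e = ne (≡.subst (λ z → mulMon z m₂ ≡ m) (mulMon-cancelʳ e) e)

  *P-congˡ : ∀ {p p′} q → p ≋ p′ → (p *P q) ≋ (p′ *P q)
  *P-congˡ {p} {p′} []      _     = ≡⇒≋ (≡.trans (*P-zeroʳ p) (≡.sym (*P-zeroʳ p′)))
  *P-congˡ {p} {p′} (t ∷ q) p≋p′ =
    ≋-trans (*P-∷ʳ p t q) (≋-trans (++-cong (▹-cong t p≋p′) (*P-congˡ q p≋p′)) (≋-sym (*P-∷ʳ p′ t q)))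

  *P-comm : ∀ p q → (p *P q) ≋ (q *P p)
  *P-comm []      q = ≡⇒≋ (≡.sym (*P-zeroʳ q))
  *P-comm (t ∷ p) q = ≋-trans (++-cong (◃≋▹ t q) (*P-comm p q)) (≋-sym (*P-∷ʳ q t p))

  *P-congʳ : ∀ p {q q′} → q ≋ q′ → (p *P q) ≋ (p *P q′)
  *P-congʳ p {q} {q′} q≋q′ = ≋-trans (*P-comm p q) (≋-trans (*P-congˡ p q≋q′) (*P-comm q′ p))

  *P-distribʳ : ∀ r p q → ((p ++ q) *P r) ≡ ((p *P r) ++ (q *P r))
  *P-distribʳ r []      q = ≡.refl
  *P-distribʳ r (s ∷ p) q = ≡.trans (≡.cong ((s ◃ r) ++_) (*P-distribʳ r p q))
                                   (≡.sym (List.++-assoc (s ◃ r) (p *P r) (q *P r)))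

  *P-distribˡ : ∀ r p q → (r *P (p ++ q)) ≋ ((r *P p) ++ (r *P q))
  *P-distribˡ r p q = ≋-trans (*P-comm r (p ++ q))
    (≋-trans (≡⇒≋ (*P-distribʳ r p q)) (++-cong (*P-comm p r) (*P-comm q r)))

  ◃-◃ : ∀ s t r → ((proj₁ s *K proj₁ t , mulMon (proj₂ s) (proj₂ t)) ◃ r) ≋ (s ◃ (t ◃ r))
  ◃-◃ (a , m₁) (b , m₂) r = ≋-trans
    (map-cong _ _ (λ u → *-assoc a b (proj₁ u)) (λ u → mulMon-assoc m₁ m₂ (proj₂ u)) r)
    (≡⇒≋ (List.map-∘ r))

  ◃-*P : ∀ t q r → ((t ◃ q) *P r) ≋ (t ◃ (q *P r))
  ◃-*P t []      r = ≋-refl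
  ◃-*P t (s ∷ q) r = ≋-trans (++-cong (◃-◃ t s r) (◃-*P t q r))
                             (≡⇒≋ (≡.sym (List.map-++ _ (s ◃ r) (q *P r))))

  *P-assoc : ∀ p q r → ((p *P q) *P r) ≋ (p *P (q *P r))
  *P-assoc []      q r = ≋-refl
  *P-assoc (t ∷ p) q r = ≋-trans (≡⇒≋ (*P-distribʳ r (t ◃ q) (p *P q)))
                                 (++-cong (◃-*P t q r) (*P-assoc p q r))

  *P-identityˡ : ∀ p → (1P *P p) ≋ p
  *P-identityˡ p = ≋-trans (≡⇒≋ (List.++-identityʳ _)) (≋-trans
    (map-cong _ (λ t → t) (λ t → *-identityˡ (proj₁ t)) (λ t → mulMon-identityˡ (proj₂ t)) p)
    (≡⇒≋ (List.map-id p)))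

  isCommutativeRing : IsCommutativeRing _≋_ _+P_ _*P_ -P_ 0P 1P
  isCommutativeRing = record
    { isRing = record
      { +-isAbelianGroup = record
        { isGroup = record
          { isMonoid = record
            { isSemigroup = record
              { isMagma = record
                { isEquivalence = record { refl = ≋-refl ; sym = ≋-sym ; trans = ≋-trans }
                ; ∙-cong = ++-cong
                }
              ; assoc = λ p q r → ≡⇒≋ (List.++-assoc p q r)
              }
            ; identity = (λ p → ≋-refl) , (λ p → ≡⇒≋ (List.++-identityʳ p))
            }
          ; inverse = -P-inverseˡ , -P-inverseʳ
          ; ⁻¹-cong = -P-cong
          }
        ; comm = ++-comm
        }
      ; *-cong = λ {p} {p′} {q} p≋ q≋ → ≋-trans (*P-congˡ q p≋) (*P-congʳ p′ q≋)
      ; *-assoc = *P-assoc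
      ; *-identity = *P-identityˡ , (λ p → ≋-trans (*P-comm p 1P) (*P-identityˡ p))
      ; distrib = *P-distribˡ , (λ r p q → ≡⇒≋ (*P-distribʳ r p q))
      }
    ; *-comm = *P-comm
    }

  polynomialRing : CommutativeRing c ℓ
  polynomialRing = record { isCommutativeRing = isCommutativeRing }

module QuotientRing {c ℓ : Level} (R : CommutativeRing c ℓ) where
  open CommutativeRing R
  open import Relation.Binary.Reasoning.Setoid setoid
  open import Algebra.Properties.Ring ring using (-1*x≈-x; x[y-z]≈xy-xz)
  open import Algebra.Properties.AbelianGroup +-abelianGroup using (⁻¹-anti-homo‿-; ⁻¹-∙-comm)
  open import Algebra.Properties.Group +-group using (x≈y⇒x∙y⁻¹≈ε)
  open import Algebra.Properties.CommutativeSemigroup +-commutativeSemigroup using (interchange)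

  record IsIdeal {i : Level} (I : Carrier → Set i) : Set (c ⊔ ℓ ⊔ i) where
    field
      ∈-resp-≈   : ∀ {x y} → x ≈ y → I y → I x
      0∈         : I 0#
      +-closed   : ∀ {x y} → I x → I y → I (x + y)
      *-closedˡ  : ∀ r {x} → I x → I (r * x)

    -‿closed : ∀ {x} → I x → I (- x)
    -‿closed {x} x∈I = ∈-resp-≈ (sym (-1*x≈-x x)) (*-closedˡ (- 1#) x∈I)

  -‿-anti : ∀ x y → y - x ≈ - (x - y)
  -‿-anti x y = sym (⁻¹-anti-homo‿- x y)

  -‿-telescope : ∀ x y z → x - z ≈ (x - y) + (y - z)
  -‿-telescope x y z = sym (begin
    (x - y) + (y - z)       ≈⟨ +-assoc x (- y) (y - z) ⟩
    x + (- y + (y - z))     ≈⟨ +-congˡ (sym (+-assoc (- y) y (- z))) ⟩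
    x + ((- y + y) - z)     ≈⟨ +-congˡ (+-congʳ (-‿inverseˡ y)) ⟩
    x + (0# - z)            ≈⟨ +-congˡ (+-identityˡ (- z)) ⟩
    x - z ∎)

  -‿-+ : ∀ x y u v → (x + u) - (y + v) ≈ (x - y) + (u - v)
  -‿-+ x y u v = trans (+-congˡ (sym (⁻¹-∙-comm y v))) (interchange x u (- y) (- v))

  -‿-neg : ∀ x y → (- x) - (- y) ≈ - (x - y)
  -‿-neg x y = ⁻¹-∙-comm x (- y)

  -‿-* : ∀ x y u v → (x * u) - (y * v) ≈ u * (x - y) + y * (u - v)
  -‿-* x y u v = sym (begin
    u * (x - y) + y * (u - v)               ≈⟨ +-cong (x[y-z]≈xy-xz u x y) (x[y-z]≈xy-xz y u v) ⟩
    (u * x - u * y) + (y * u - y * v)       ≈⟨ +-congˡ (+-congʳ (*-comm y u)) ⟩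
    (u * x - u * y) + (u * y - y * v)       ≈⟨ -‿-telescope (u * x) (u * y) (y * v) ⟨
    u * x - y * v                           ≈⟨ +-congʳ (*-comm u x) ⟩
    x * u - y * v ∎)

  module _ {i : Level} {I : Carrier → Set i} (isIdeal : IsIdeal I) where
    open IsIdeal isIdeal

    record _∼_ (x y : Carrier) : Set i where
      constructor by-ideal
      field difference∈I : I (x - y)
    open _∼_ public

    ≈⇒∼ : ∀ {x y} → x ≈ y → x ∼ y
    ≈⇒∼ x≈y = by-ideal (∈-resp-≈ (x≈y⇒x∙y⁻¹≈ε x≈y) 0∈)

    isCommutativeRing/I : IsCommutativeRing _∼_ _+_ _*_ -_ 0# 1#
    isCommutativeRing/I = record
      { isRing = record
        { +-isAbelianGroup = record
          { isGroup = record
            { isMonoid = record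
              { isSemigroup = record
                { isMagma = record
                  { isEquivalence = record
                    { refl  = ≈⇒∼ refl
                    ; sym   = λ {x} {y} x∼y → by-ideal (∈-resp-≈ (-‿-anti x y) (-‿closed (difference∈I x∼y)))
                    ; trans = λ {x} {y} {z} x∼y y∼z → by-ideal
                        (∈-resp-≈ (-‿-telescope x y z) (+-closed (difference∈I x∼y) (difference∈I y∼z)))
                    }
                  ; ∙-cong = λ {x} {y} {u} {v} x∼y u∼v → by-ideal
                      (∈-resp-≈ (-‿-+ x y u v) (+-closed (difference∈I x∼y) (difference∈I u∼v)))
                  }
                ; assoc = λ x y z → ≈⇒∼ (+-assoc x y z)
                }
              ; identity = (λ x → ≈⇒∼ (+-identityˡ x)) , (λ x → ≈⇒∼ (+-identityʳ x))
              }
            ; inverse = (λ x → ≈⇒∼ (-‿inverseˡ x)) , (λ x → ≈⇒∼ (-‿inverseʳ x))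
            ; ⁻¹-cong = λ {x} {y} x∼y → by-ideal (∈-resp-≈ (-‿-neg x y) (-‿closed (difference∈I x∼y)))
            }
          ; comm = λ x y → ≈⇒∼ (+-comm x y)
          }
        ; *-cong = λ {x} {y} {u} {v} x∼y u∼v → by-ideal (∈-resp-≈ (-‿-* x y u v)
            (+-closed (*-closedˡ u (difference∈I x∼y)) (*-closedˡ y (difference∈I u∼v))))
        ; *-assoc = λ x y z → ≈⇒∼ (*-assoc x y z)
        ; *-identity = (λ x → ≈⇒∼ (*-identityˡ x)) , (λ x → ≈⇒∼ (*-identityʳ x))
        ; distrib = (λ x y z → ≈⇒∼ (distribˡ x y z)) , (λ x y z → ≈⇒∼ (distribʳ x y z))
        }
      ; *-comm = λ x y → ≈⇒∼ (*-comm x y)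
      }

    quotientRing : CommutativeRing c i
    quotientRing = record { isCommutativeRing = isCommutativeRing/I }

module SymmetricPolynomials {c ℓ : Level} (R : CommutativeRing c ℓ) where
  open CommutativeRing R
  open import Relation.Binary.Reasoning.Setoid setoid

  elementary : ℕ → List Carrier → Carrier
  elementary zero    _        = 1#
  elementary (suc k) []       = 0#
  elementary (suc k) (v ∷ vs) = v * elementary k vs + elementary (suc k) vs

  complete : ℕ → List Carrier → Carrier
  complete zero    _        = 1#
  complete (suc k) []       = 0#
  complete (suc k) (v ∷ vs) = complete (suc k) vs + v * complete k (v ∷ vs)

  sign : ℕ → Carrier
  sign zero    = 1#
  sign (suc k) = - sign k

  elementary-vanishes : ∀ {k} vs → length vs < k → elementary k vs ≈ 0#
  elementary-vanishes {suc k}       []       _         = refl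
  elementary-vanishes {suc (suc k)} (v ∷ vs) (s≤s len<) = begin
    v * elementary (suc k) vs + elementary (suc (suc k)) vs
      ≈⟨ +-cong (*-congˡ (elementary-vanishes vs len<)) (elementary-vanishes vs (ℕ.m<n⇒m<1+n len<)) ⟩
    v * 0# + 0# ≈⟨ +-identityʳ _ ⟩
    v * 0#      ≈⟨ zeroʳ v ⟩
    0# ∎

  private
    cancel-step : ∀ s v a b → (- s) * (v * a + b) + v * (s * a) ≈ (- s) * b
    cancel-step s v a b = begin
      (- s) * (v * a + b) + v * (s * a)         ≈⟨ +-congʳ (distribˡ (- s) (v * a) b) ⟩
      ((- s) * (v * a) + (- s) * b) + v * (s * a) ≈⟨ +-cong (+-comm _ _) (x∙yz≈y∙xz v s a) ⟩
      ((- s) * b + (- s) * (v * a)) + s * (v * a) ≈⟨ +-assoc _ _ _ ⟩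
      (- s) * b + ((- s) * (v * a) + s * (v * a)) ≈⟨ +-congˡ (sym (distribʳ (v * a) (- s) s)) ⟩
      (- s) * b + (- s + s) * (v * a)           ≈⟨ +-congˡ (trans (*-congʳ (-‿inverseˡ s)) (zeroˡ _)) ⟩
      (- s) * b + 0#                            ≈⟨ +-identityʳ _ ⟩
      (- s) * b ∎
      where open import Algebra.Properties.CommutativeSemigroup *-commutativeSemigroup using (x∙yz≈y∙xz)

  -- Stated with ʳ++ so that moving u from u ∷ us to u ∷ vs leaves us ʳ++ vs unchanged definitionally.
  complete≈±elementary : ∀ us vs → (∀ k → elementary (suc k) (us ʳ++ vs) ≈ 0#) →
                         ∀ k → complete k us ≈ sign k * elementary k vs
  complete≈±elementary []       vs e≈0 zero    = sym (*-identityˡ 1#)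
  complete≈±elementary []       vs e≈0 (suc k) = sym (trans (*-congˡ (e≈0 k)) (zeroʳ _))
  complete≈±elementary (u ∷ us) vs e≈0 = go
    where
    IH : ∀ k → complete k us ≈ sign k * elementary k (u ∷ vs)
    IH = complete≈±elementary us (u ∷ vs) e≈0
    go : ∀ k → complete k (u ∷ us) ≈ sign k * elementary k vs
    go zero    = sym (*-identityˡ 1#)
    go (suc k) = begin
      complete (suc k) us + u * complete k (u ∷ us)
        ≈⟨ +-cong (IH (suc k)) (*-congˡ (go k)) ⟩
      (- sign k) * (u * elementary k vs + elementary (suc k) vs) + u * (sign k * elementary k vs)
        ≈⟨ cancel-step (sign k) u (elementary k vs) (elementary (suc k) vs) ⟩
      (- sign k) * elementary (suc k) vs ∎

  complete-vanishes : ∀ us vs → (∀ k → elementary (suc k) (us ʳ++ vs) ≈ 0#) →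
                      ∀ {k} → length vs < k → complete k us ≈ 0#
  complete-vanishes us vs e≈0 {k} len< = trans (complete≈±elementary us vs e≈0 k)
    (trans (*-congˡ (elementary-vanishes vs len<)) (zeroʳ _))

module GeneratedIdeal {c ℓ : Level} (K : Field c ℓ) (n : ℕ) (gs : List (Poly.Pol K n)) where
  open Poly K n
  open PolynomialRing K n using (polynomialRing; _≋_; coeffwise; coeff-≈)
  open CommutativeRing polynomialRing hiding (zero)
  open QuotientRing polynomialRing using (IsIdeal)
  open import Relation.Binary.Reasoning.Setoid setoid

  combination : (Fin (length gs) → Pol) → List (Fin (length gs)) → Pol
  combination g is = sumP (List.map (λ i → g i *P List.lookup gs i) is)

  combination-+ : ∀ g h is → combination (λ i → g i +P h i) is ≈ combination g is + combination h is
  combination-+ g h []       = sym (+-identityʳ [])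
  combination-+ g h (i ∷ is) = begin
    (g i + h i) * gᵢ + combination (λ i → g i +P h i) is
      ≈⟨ +-cong (distribʳ gᵢ (g i) (h i)) (combination-+ g h is) ⟩
    (g i * gᵢ + h i * gᵢ) + (combination g is + combination h is)
      ≈⟨ interchange (g i * gᵢ) (h i * gᵢ) (combination g is) (combination h is) ⟩
    (g i * gᵢ + combination g is) + (h i * gᵢ + combination h is) ∎
    where
    gᵢ = List.lookup gs i
    open import Algebra.Properties.CommutativeSemigroup +-commutativeSemigroup using (interchange)

  combination-* : ∀ r g is → r * combination g is ≈ combination (λ i → r *P g i) is
  combination-* r g []       = zeroʳ r
  combination-* r g (i ∷ is) = trans (distribˡ r _ _)
    (+-cong (sym (*-assoc r (g i) (List.lookup gs i))) (combination-* r g is))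

  combination-0 : ∀ is → combination (λ _ → 0P) is ≡ []
  combination-0 []       = ≡.refl
  combination-0 (i ∷ is) = combination-0 is

  private
    all : List (Fin (length gs))
    all = List.allFin (length gs)

    combination-≈ : ∀ {p} (p∈I : InIdeal gs p) → p ≈ combination (proj₁ p∈I) all
    combination-≈ (g , p≈) = coeffwise p≈

  isIdeal : IsIdeal (InIdeal gs)
  isIdeal = record
    { ∈-resp-≈  = λ { {p} {q} p≈q q∈I@(g , _) → g , coeff-≈ (trans p≈q (combination-≈ {q} q∈I)) }
    ; 0∈        = (λ _ → 0P) , coeff-≈ (reflexive (≡.sym (combination-0 all)))
    ; +-closed  = λ { {p} {q} p∈I@(g , _) q∈I@(h , _) → (λ i → g i +P h i) , coeff-≈
                    (trans (+-cong (combination-≈ {p} p∈I) (combination-≈ {q} q∈I)) (sym (combination-+ g h all))) }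
    ; *-closedˡ = λ { r {p} p∈I@(g , _) → (λ i → r *P g i) , coeff-≈
                    (trans (*-congˡ {r} (combination-≈ {p} p∈I)) (combination-* r g all)) }
    }

  δ : ∀ {m} → Fin m → Fin m → Pol
  δ zero    zero    = 1P
  δ zero    (suc _) = 0P
  δ (suc _) zero    = 0P
  δ (suc k) (suc i) = δ k i

  sum-δ : ∀ {m} (k : Fin m) (F : Fin m → Pol) → sumP (List.tabulate (λ i → δ k i *P F i)) ≈ F k
  sum-δ {suc m} zero F = begin
    1P * F zero + sumP (List.tabulate {n = m} (λ _ → 0P)) ≈⟨ +-cong (*-identityˡ (F zero)) (reflexive (zeros m)) ⟩
    F zero + []                                            ≈⟨ +-identityʳ (F zero) ⟩
    F zero ∎
    where
    zeros : ∀ m → sumP (List.tabulate {n = m} (λ _ → 0P)) ≡ []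
    zeros zero    = ≡.refl
    zeros (suc m) = zeros m
  sum-δ (suc k) F = sum-δ k (λ i → F (suc i))

  generator∈ : ∀ {p} → p ∈ gs → InIdeal gs p
  generator∈ p∈gs = ≡.subst (InIdeal gs) (≡.sym (lookup-index p∈gs)) (δ k , coeff-≈ (sym (trans
    (reflexive (≡.cong sumP (List.map-tabulate (λ i → i) (λ i → δ k i *P List.lookup gs i))))
    (sum-δ k (List.lookup gs)))))
    where k = index p∈gs

module Spans {c ℓ : Level} (K : Field c ℓ) (n : ℕ) (gs : List (Poly.Pol K n)) where
  open Poly K n
  open Field K using (Carrier; 1#) renaming (_*_ to _*K_; -_ to -K_)
  open PolynomialRing K n using (polynomialRing; _≋_; ≋-trans; map-cong; singleton-cong; ≡⇒≋)
  open GeneratedIdeal K n gs using (isIdeal)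
  open QuotientRing polynomialRing using (quotientRing; ≈⇒∼)
  open CommutativeRing (quotientRing isIdeal) using (_≈_; refl; sym; trans; reflexive; +-cong; *-congˡ)

  Exponent : Set
  Exponent = Vec ℕ n

  _⊕_ : Exponent → Exponent → Exponent
  _⊕_ = zipWith ℕ._+_

  monomial : Exponent → Pol
  monomial e = liftX ((1# , e) ∷ [])

  scaled : Carrier → Exponent → Pol
  scaled a e = liftX ((a , e) ∷ [])

  -- ≈ is congruence modulo the ideal generated by gs.
  Span : (Exponent → Set) → Pol → Set (c ⊔ ℓ)
  Span P p = ∃ λ (cs : PolX) → All (λ t → P (proj₂ t)) cs × p ≈ liftX cs

  module _ {P : Exponent → Set} where

    span-resp : ∀ {p q} → p ≈ q → Span P q → Span P p
    span-resp p≈q (cs , P-cs , q≈) = cs , P-cs , trans p≈q q≈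

    span-0 : Span P 0P
    span-0 = [] , [] , refl

    span-+ : ∀ {p q} → Span P p → Span P q → Span P (p +P q)
    span-+ (cs , P-cs , p≈) (ds , P-ds , q≈) =
      cs ++ ds , All.++⁺ P-cs P-ds , trans (+-cong p≈ q≈) (reflexive (≡.sym (List.map-++ _ cs ds)))

    span-monomial : ∀ {e} → P e → Span P (monomial e)
    span-monomial P-e = _ , P-e ∷ [] , refl

  span-mono : ∀ {P Q : Exponent → Set} → (∀ {f} → P f → Q f) → ∀ {p} → Span P p → Span Q p
  span-mono P⇒Q (cs , P-cs , p≈) = cs , All.map P⇒Q P-cs , p≈

  scaled*liftX : ∀ a g cs →
    scaled a g *P liftX cs ≋ liftX (List.map (λ { (b , f) → (a *K b , g ⊕ f) }) cs)
  scaled*liftX a g cs =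
    ≋-trans (≡⇒≋ (List.++-identityʳ _)) (≋-trans (≡⇒≋ (≡.sym (List.map-∘ cs)))
    (≋-trans (map-cong _ _ (λ _ → Field.refl K) (λ t → ≡.cong (g ⊕ proj₂ t ,_) 0⊕0≡0) cs)
             (≡⇒≋ (List.map-∘ cs))))
    where
    0⊕0≡0 : replicate n 0 ⊕ replicate n 0 ≡ replicate n 0
    0⊕0≡0 = Vec.zipWith-identityˡ ℕ.+-identityˡ (replicate n 0)

  0⊕ : ∀ f → replicate n 0 ⊕ f ≡ f
  0⊕ = Vec.zipWith-identityˡ ℕ.+-identityˡ

  span-scale : ∀ {P : Exponent → Set} a {p} → Span P p → Span P (scaled a (replicate n 0) *P p)
  span-scale {P} a (cs , P-cs , p≈) =
    _ , All.map⁺ (All.map (λ {t} → ≡.subst P (≡.sym (0⊕ (proj₂ t)))) P-cs) ,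
    trans (*-congˡ {scaled a _} p≈) (≈⇒∼ isIdeal (scaled*liftX a _ cs))

  span-neg : ∀ {P : Exponent → Set} {p} → Span P p → Span P (-P p)
  span-neg {p = p} = span-resp (sym (-1*x≈-x p)) ∘ span-scale (-K 1#)
    where open import Algebra.Properties.Ring (CommutativeRing.ring (quotientRing isIdeal)) using (-1*x≈-x)

  scaled≈scale*monomial : ∀ a e → scaled a e ≈ scaled a (replicate n 0) *P monomial e
  scaled≈scale*monomial a e = sym (≈⇒∼ isIdeal (≋-trans (scaled*liftX a _ ((1# , e) ∷ []))
    (singleton-cong (Field.*-identityʳ K a) (≡.cong (_, replicate n 0) (0⊕ e)))))

  span-bind : ∀ {P Q : Exponent → Set} → (∀ {e} → P e → Span Q (monomial e)) → ∀ {p} → Span P p → Span Q p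
  span-bind {P} {Q} P⇒Q (cs , P-cs , p≈) = span-resp p≈ (go cs P-cs)
    where
    go : ∀ cs → All (λ t → P (proj₂ t)) cs → Span Q (liftX cs)
    go []             []           = span-0
    go ((a , e) ∷ cs) (P-e ∷ P-cs) =
      span-+ (span-resp (scaled≈scale*monomial a e) (span-scale a (P⇒Q P-e))) (go cs P-cs)

  monomial-* : ∀ g f → monomial g *P monomial f ≈ monomial (g ⊕ f)
  monomial-* g f = ≈⇒∼ isIdeal (≋-trans (scaled*liftX 1# g ((1# , f) ∷ []))
    (singleton-cong (Field.*-identityʳ K 1#) ≡.refl))

  span-descent : ∀ {Inv T : Exponent → Set} (μ : Exponent → ℕ) →
                 (∀ {e} → Inv e → Span (λ f → T f ⊎ (Inv f × μ f ℕ.< μ e)) (monomial e)) →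
                 ∀ {e} → Inv e → Span T (monomial e)
  span-descent {Inv} {T} μ step {e} inv = go e (<-wellFounded (μ e)) inv
    where
    go : ∀ e → Acc ℕ._<_ (μ e) → Inv e → Span T (monomial e)
    go e (acc rec) inv = span-bind [ span-monomial , (λ { (inv′ , μ<) → go _ (rec μ<) inv′ }) ] (step inv)

module Reduction {c ℓ : Level} (K : Field c ℓ) (n h1 : ℕ) where
  open Setup K n h1
  open PolynomialRing K n using (polynomialRing; ≡⇒≋)
  open GeneratedIdeal K n gens using (isIdeal; generator∈)
  open QuotientRing polynomialRing using (quotientRing; by-ideal; difference∈I; module IsIdeal)
  open Spans K n gens
  open CommutativeRing (quotientRing isIdeal) hiding (zero)
  open SymmetricPolynomials (quotientRing isIdeal)
  open import Relation.Binary.Reasoning.Setoid setoid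

  generator≈0 : ∀ {p} → p ∈ gens → p ≈ 0P
  generator≈0 {p} p∈gens =
    by-ideal (IsIdeal.∈-resp-≈ isIdeal (≡⇒≋ (List.++-identityʳ p)) (generator∈ p∈gens))

  finalVariables : ℕ → List Pol
  finalVariables j = List.map x (range (suc j) n)

  length-finalVariables : ∀ j → length (finalVariables j) ≡ n ∸ j
  length-finalVariables j = ≡.trans (List.length-map x (range (suc j) n)) (length-range j n)

  variables : List Pol
  variables = finalVariables 0

  esym≡elementary : ∀ k vs → esym k vs ≡ elementary k vs
  esym≡elementary zero    vs       = ≡.refl
  esym≡elementary (suc k) []       = ≡.refl
  esym≡elementary (suc k) (v ∷ vs) =
    ≡.cong₂ (λ a b → v * a + b) (esym≡elementary k vs) (esym≡elementary (suc k) vs)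

  elementary-variables≈0 : ∀ k → elementary (suc k) variables ≈ 0P
  elementary-variables≈0 k = by-cases (suc k ℕ.≤? n)
    where
    by-cases : Dec (suc k ≤ n) → elementary (suc k) variables ≈ 0P
    by-cases (yes k<n) = ≡.subst (_≈ 0P) (esym≡elementary (suc k) variables)
      (generator≈0 (∈-++⁺ʳ gensYY (∈-++⁺ʳ gensXY (∈-++⁺ʳ gensProd
        (there (∈-map⁺ (λ i → esym i variables) (∈-range k<n)))))))
    by-cases (no k≮n)  = elementary-vanishes variables
      (ℕ.≤-trans (ℕ.≤-reflexive (≡.cong suc (length-finalVariables 0))) (ℕ.≰⇒> k≮n))

  -- Largest index first, so that complete splits off the powers of the head variable.
  initialVariables : ℕ → List Pol
  initialVariables zero    = []
  initialVariables (suc j) = x (suc j) ∷ initialVariables j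

  initialVariables-ʳ++-finalVariables : ∀ {j} → j ≤ n → initialVariables j ʳ++ finalVariables j ≡ variables
  initialVariables-ʳ++-finalVariables {zero}  _   = ≡.refl
  initialVariables-ʳ++-finalVariables {suc j} j<n = ≡.trans
    (≡.cong (λ ls → initialVariables j ʳ++ List.map x ls) (≡.sym (range-∷ j<n)))
    (initialVariables-ʳ++-finalVariables (ℕ.<⇒≤ j<n))

  complete-initialVariables≈0 : ∀ {j} → j < n → complete (n ∸ j) (initialVariables (suc j)) ≈ 0P
  complete-initialVariables≈0 {j} j<n =
    complete-vanishes (initialVariables (suc j)) (finalVariables (suc j)) elementary≈0 length<
    where
    elementary≈0 : ∀ k → elementary (suc k) (initialVariables (suc j) ʳ++ finalVariables (suc j)) ≈ 0P
    elementary≈0 k = ≡.subst (λ vs → elementary (suc k) vs ≈ 0P)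
      (≡.sym (initialVariables-ʳ++-finalVariables j<n)) (elementary-variables≈0 k)
    length< : length (finalVariables (suc j)) < n ∸ j
    length< = ℕ.≤-reflexive (≡.sym (≡.trans (∸-suc j<n) (≡.cong suc (≡.sym (length-finalVariables (suc j))))))

  differenceProduct : ℕ → Pol
  differenceProduct b = prodP (List.map (λ l → x 1 -P x l) (range (suc b) h1))

  differenceProduct-∷ : ∀ {b} → b < h1 → differenceProduct b ≡ (x 1 -P x (suc b)) *P differenceProduct (suc b)
  differenceProduct-∷ b<h1 = ≡.cong (λ ls → prodP (List.map (λ l → x 1 -P x l) ls)) (range-∷ b<h1)

  differenceProduct-[] : differenceProduct h1 ≡ 1P
  differenceProduct-[] = ≡.cong (λ ls → prodP (List.map (λ l → x 1 -P x l) ls)) (range-[] {h1} {h1} ℕ.≤-refl)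

  sum-generators≈0 : ∀ {ps} → All (_∈ gens) ps → sumP ps ≈ 0P
  sum-generators≈0 All.[]         = refl
  sum-generators≈0 (p∈ All.∷ ps∈) = trans (+-cong (generator≈0 p∈) (sum-generators≈0 ps∈)) (+-identityʳ 0P)

  *-sum-map : ∀ a (f : ℕ → Pol) ls → a * sumP (List.map f ls) ≈ sumP (List.map (λ l → a * f l) ls)
  *-sum-map a f []       = zeroʳ a
  *-sum-map a f (l ∷ ls) = trans (distribˡ a (f l) _) (+-congˡ (*-sum-map a f ls))

  -- x₁ yₖ ∈ I for all k, and Σₖ yₖ ≡ ∏_{l=2}^{h1} (x₁ - x_l)
  x₁*differenceProduct≈0 : x 1 * differenceProduct 1 ≈ 0P
  x₁*differenceProduct≈0 = begin
    x 1 * differenceProduct 1                         ≈⟨ *-congˡ {x 1} (x∙y⁻¹≈ε⇒x≈y (sumP (List.map y (range 1 n))) (differenceProduct 1) (generator≈0 genSum∈gens)) ⟨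
    x 1 * sumP (List.map y (range 1 n))               ≈⟨ *-sum-map (x 1) y (range 1 n) ⟩
    sumP (List.map (λ k → x 1 * y k) (range 1 n))     ≈⟨ sum-generators≈0 {List.map (λ k → x 1 * y k) (range 1 n)} (All.tabulate (λ p∈ → ∈-++⁺ʳ gensYY (∈-++⁺ˡ p∈))) ⟩
    0P ∎
    where
    open import Algebra.Properties.Group +-group using (x∙y⁻¹≈ε⇒x≈y)
    genSum∈gens : genSum ∈ gens
    genSum∈gens = ∈-++⁺ʳ gensYY (∈-++⁺ʳ gensXY (∈-++⁺ʳ gensProd (here ≡.refl)))

  -- Position j of an exponent vector (the k : Fin n with toℕ k ≡ j) holds the exponent of x_{j+1}.
  raise : ℕ → Exponent → Exponent
  raise j g = g ⊕ unit (suc j)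

  lookup-raise-≡ : ∀ {j} g k → toℕ k ≡ j → lookup (raise j g) k ≡ suc (lookup g k)
  lookup-raise-≡ {j} g k k≡j = ≡.trans (Vec.lookup-zipWith ℕ._+_ k g _) (≡.trans
    (≡.cong (lookup g k ℕ.+_) (≡.trans (Vec.lookup∘tabulate _ k) (Bool.if-cong (dec-true (suc (toℕ k) ℕ.≟ suc j) (≡.cong suc k≡j)))))
    (ℕ.+-comm (lookup g k) 1))

  lookup-raise-≢ : ∀ {j} g k → toℕ k ≢ j → lookup (raise j g) k ≡ lookup g k
  lookup-raise-≢ {j} g k k≢j = ≡.trans (Vec.lookup-zipWith ℕ._+_ k g _) (≡.trans
    (≡.cong (lookup g k ℕ.+_) (≡.trans (Vec.lookup∘tabulate _ k) (Bool.if-cong (dec-false (suc (toℕ k) ℕ.≟ suc j) (k≢j ∘ ℕ.suc-injective)))))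
    (ℕ.+-identityʳ (lookup g k)))

  raiseBy : ℕ → ℕ → Exponent → Exponent
  raiseBy j zero    g = g
  raiseBy j (suc m) g = raiseBy j m (raise j g)

  lookup-raiseBy-≡ : ∀ {j} m g k → toℕ k ≡ j → lookup (raiseBy j m g) k ≡ lookup g k ℕ.+ m
  lookup-raiseBy-≡ zero    g k _   = ≡.sym (ℕ.+-identityʳ (lookup g k))
  lookup-raiseBy-≡ (suc m) g k k≡j = ≡.trans (lookup-raiseBy-≡ m _ k k≡j)
    (≡.trans (≡.cong (ℕ._+ m) (lookup-raise-≡ g k k≡j)) (≡.sym (ℕ.+-suc (lookup g k) m)))

  lookup-raiseBy-≢ : ∀ {j} m g k → toℕ k ≢ j → lookup (raiseBy j m g) k ≡ lookup g k
  lookup-raiseBy-≢ zero    g k _   = ≡.refl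
  lookup-raiseBy-≢ (suc m) g k k≢j = ≡.trans (lookup-raiseBy-≢ m _ k k≢j) (lookup-raise-≢ g k k≢j)

  lowerBy : ℕ → ℕ → Exponent → Exponent
  lowerBy j m e = tabulate (λ k → if does (toℕ k ℕ.≟ j) then lookup e k ∸ m else lookup e k)

  raiseBy-lowerBy : ∀ j m e → (∀ k → toℕ k ≡ j → m ≤ lookup e k) → raiseBy j m (lowerBy j m e) ≡ e
  raiseBy-lowerBy j m e m≤e = lookup-ext (λ k → by-cases k (toℕ k ℕ.≟ j))
    where
    lookup-lowerBy : ∀ k → lookup (lowerBy j m e) k ≡ (if does (toℕ k ℕ.≟ j) then lookup e k ∸ m else lookup e k)
    lookup-lowerBy k = Vec.lookup∘tabulate _ k
    by-cases : ∀ k → Dec (toℕ k ≡ j) → lookup (raiseBy j m (lowerBy j m e)) k ≡ lookup e k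
    by-cases k (yes k≡j) = ≡.trans (lookup-raiseBy-≡ m _ k k≡j)
      (≡.trans (≡.cong (ℕ._+ m) (≡.trans (lookup-lowerBy k) (Bool.if-cong (dec-true (toℕ k ℕ.≟ j) k≡j)))) (ℕ.m∸n+n≡m (m≤e k k≡j)))
    by-cases k (no k≢j)  = ≡.trans (lookup-raiseBy-≢ m _ k k≢j)
      (≡.trans (lookup-lowerBy k) (Bool.if-cong (dec-false (toℕ k ℕ.≟ j) k≢j)))

  monomial*x : ∀ j g → monomial g * x (suc j) ≈ monomial (raise j g)
  monomial*x j g = monomial-* g (unit (suc j))

  -- Artin reduction

  AgreeFrom : ℕ → Exponent → Exponent → Set
  AgreeFrom j g f = ∀ k → j ≤ toℕ k → lookup f k ≡ lookup g k

  DropsAt : ℕ → Exponent → Exponent → Set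
  DropsAt j e f = (∀ k → toℕ k ≡ j → lookup f k < lookup e k) × AgreeFrom (suc j) e f

  monomial*-expand : ∀ g j a b → monomial g * (a + x (suc j) * b) ≈ monomial g * a + monomial (raise j g) * b
  monomial*-expand g j a b =
    trans (distribˡ (monomial g) a (x (suc j) * b))
          (+-congˡ {monomial g * a} (trans (sym (*-assoc (monomial g) (x (suc j)) b)) (*-congʳ (monomial*x j g))))

  span-monomial*complete : ∀ j k g → Span (AgreeFrom j g) (monomial g * complete k (initialVariables j))
  span-monomial*complete j       zero    g = span-resp (*-identityʳ (monomial g)) (span-monomial (λ _ _ → ≡.refl))
  span-monomial*complete zero    (suc k) g = span-resp (zeroʳ (monomial g)) span-0
  span-monomial*complete (suc j) (suc k) g =
    span-resp (monomial*-expand g j (complete (suc k) (initialVariables j)) (complete k (initialVariables (suc j))))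
    (span-+ (span-mono (λ agree k j<k → agree k (ℕ.<⇒≤ j<k)) (span-monomial*complete j (suc k) g))
            (span-mono (λ agree k j<k → ≡.trans (agree k j<k) (lookup-raise-≢ g k (ℕ.>⇒≢ j<k)))
                       (span-monomial*complete (suc j) k (raise j g))))

  span-monomial*complete-raised : ∀ j m g →
    Span (DropsAt j (raiseBy j m g)) (monomial g * complete m (initialVariables (suc j)) - monomial (raiseBy j m g))
  span-monomial*complete-raised j zero    g =
    span-resp (trans (+-congʳ (*-identityʳ (monomial g))) (-‿inverseʳ (monomial g))) span-0
  span-monomial*complete-raised j (suc m) g =
    span-resp (trans (+-congʳ (monomial*-expand g j A B)) (+-assoc (monomial g * A) (monomial (raise j g) * B) (- monomial (raiseBy j (suc m) g))))
      (span-+ {p = monomial g * A} (span-mono (λ {f} → drops {f}) (span-monomial*complete j (suc m) g))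
              (span-monomial*complete-raised j m (raise j g)))
    where
    A = complete (suc m) (initialVariables j)
    B = complete m (initialVariables (suc j))
    drops : ∀ {f} → AgreeFrom j g f → DropsAt j (raiseBy j (suc m) g) f
    drops agree = (λ k k≡j → ℕ.≤-trans (ℕ.≤-reflexive (≡.cong suc (agree k (ℕ.≤-reflexive (≡.sym k≡j)))))
                                 (ℕ.≤-trans (ℕ.m<m+n (lookup g k) (s≤s z≤n)) (ℕ.≤-reflexive (≡.sym (lookup-raiseBy-≡ (suc m) g k k≡j)))))
                , (λ k j<k → ≡.trans (agree k (ℕ.<⇒≤ j<k)) (≡.sym (lookup-raiseBy-≢ (suc m) g k (ℕ.>⇒≢ j<k))))

  monomial*complete-x₁ : ∀ m g → monomial g * complete m (initialVariables 1) ≈ monomial (raiseBy 0 m g)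
  monomial*complete-x₁ zero    g = *-identityʳ (monomial g)
  monomial*complete-x₁ (suc m) g = begin
    monomial g * (0P + x 1 * h)  ≈⟨ *-congˡ {monomial g} (+-identityˡ (x 1 * h)) ⟩
    monomial g * (x 1 * h)       ≈⟨ *-assoc (monomial g) (x 1) h ⟨
    (monomial g * x 1) * h        ≈⟨ *-congʳ (monomial*x 0 g) ⟩
    monomial (raise 0 g) * h      ≈⟨ monomial*complete-x₁ m (raise 0 g) ⟩
    monomial (raiseBy 0 (suc m) g) ∎
    where h = complete m (initialVariables 1)

  -- h_{n-j}(x₁, …, x_{j+1}) ∈ I, and x_{j+1}^{n-j} is its only monomial with x_{j+1}-exponent n - j.
  span-drop : ∀ {j} → j < n → ∀ e → (∀ k → toℕ k ≡ j → n ∸ j ≤ lookup e k) → Span (DropsAt j e) (monomial e)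
  span-drop {j} j<n e big = ≡.subst (λ e′ → Span (DropsAt j e′) (monomial e′)) (raiseBy-lowerBy j (n ∸ j) e big)
    (span-resp E≈-[M-E] (span-neg (span-monomial*complete-raised j (n ∸ j) g)))
    where
    open import Algebra.Properties.Group +-group using (⁻¹-involutive)
    g = lowerBy j (n ∸ j) e
    E = monomial (raiseBy j (n ∸ j) g)
    M = monomial g * complete (n ∸ j) (initialVariables (suc j))
    E≈-[M-E] : E ≈ - (M - E)
    E≈-[M-E] = sym (begin
      - (M - E)   ≈⟨ -‿cong (+-congʳ (trans (*-congˡ {monomial g} (complete-initialVariables≈0 j<n)) (zeroʳ (monomial g)))) ⟩
      - (0P - E)  ≈⟨ -‿cong (+-identityˡ (- E)) ⟩
      - (- E)     ≈⟨ ⁻¹-involutive E ⟩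
      E ∎)

  x₁-power-vanishes : 0 < n → ∀ e → (∀ k → toℕ k ≡ 0 → n ≤ lookup e k) → monomial e ≈ 0P
  x₁-power-vanishes 0<n e big = begin
    monomial e                                     ≡⟨ ≡.cong monomial (raiseBy-lowerBy 0 n e big) ⟨
    monomial (raiseBy 0 n g)                       ≈⟨ monomial*complete-x₁ n g ⟨
    monomial g * complete n (initialVariables 1)   ≈⟨ *-congˡ {monomial g} (complete-initialVariables≈0 0<n) ⟩
    monomial g * 0P                                ≈⟨ zeroʳ (monomial g) ⟩
    0P ∎
    where g = lowerBy 0 n e

  -- Monomials divisible by x₁ ⋯ x_{h1}

  lookup-raise-≥ : ∀ j g k → lookup g k ≤ lookup (raise j g) k
  lookup-raise-≥ j g k = ℕ.≤-trans (ℕ.m≤m+n (lookup g k) _) (ℕ.≤-reflexive (≡.sym (Vec.lookup-zipWith ℕ._+_ k g _)))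

  *-[-]* : ∀ a u v q → a * ((u - v) * q) ≈ (a * u) * q - (a * v) * q
  *-[-]* a u v q = begin
    a * ((u - v) * q)               ≈⟨ *-assoc a (u - v) q ⟨
    (a * (u - v)) * q               ≈⟨ *-congʳ (x[y-z]≈xy-xz a u v) ⟩
    (a * u - a * v) * q             ≈⟨ [y-z]x≈yx-zx q (a * u) (a * v) ⟩
    (a * u) * q - (a * v) * q ∎
    where open import Algebra.Properties.Ring ring using (x[y-z]≈xy-xz; [y-z]x≈yx-zx)

  Bounded : Exponent → Exponent → Exponent → Set
  Bounded H B f = (∀ k → toℕ k ≡ 0 → lookup H k ≤ lookup f k) × (∀ k → 1 ≤ toℕ k → lookup f k ≤ lookup B k)

  span-monomial*differenceProduct : ∀ d b H B → d ℕ.+ b ≡ h1 →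
    (∀ k → 1 ≤ toℕ k → lookup H k ≤ lookup B k) →
    (∀ k → b ≤ toℕ k → toℕ k < h1 → lookup H k < lookup B k) →
    Span (Bounded H B) (monomial H * differenceProduct b)
  span-monomial*differenceProduct zero    b H B ≡.refl H≤B _ =
    span-resp (trans (*-congˡ {monomial H} (reflexive differenceProduct-[])) (*-identityʳ (monomial H)))
              (span-monomial ((λ _ _ → ℕ.≤-refl) , H≤B))
  span-monomial*differenceProduct (suc d) b H B d+b≡h1 H≤B H<B = span-resp expand
    (span-+ (span-mono (λ {f} → weaken {0} {f}) (IH (raise 0 H) raise₀≤ raise₀<))
            (span-neg (span-mono (λ {f} → weaken {b} {f}) (IH (raise b H) raiseᵦ≤ raiseᵦ<))))
    where
    b<h1 : b < h1
    b<h1 = ≡.subst (b <_) d+b≡h1 (s≤s (ℕ.m≤n+m b d))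
    D = differenceProduct (suc b)
    IH : ∀ H′ → (∀ k → 1 ≤ toℕ k → lookup H′ k ≤ lookup B k) →
         (∀ k → suc b ≤ toℕ k → toℕ k < h1 → lookup H′ k < lookup B k) → Span (Bounded H′ B) (monomial H′ * D)
    IH H′ = span-monomial*differenceProduct d (suc b) H′ B (≡.trans (ℕ.+-suc d b) d+b≡h1)
    expand : monomial H * differenceProduct b ≈ monomial (raise 0 H) * D - monomial (raise b H) * D
    expand = begin
      monomial H * differenceProduct b                      ≡⟨ ≡.cong (monomial H *_) (differenceProduct-∷ b<h1) ⟩
      monomial H * ((x 1 - x (suc b)) * D)                  ≈⟨ *-[-]* (monomial H) (x 1) (x (suc b)) D ⟩
      (monomial H * x 1) * D - (monomial H * x (suc b)) * D ≈⟨ +-cong (*-congʳ {D} (monomial*x 0 H)) (-‿cong (*-congʳ {D} (monomial*x b H))) ⟩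
      monomial (raise 0 H) * D - monomial (raise b H) * D ∎
    weaken : ∀ {j f} → Bounded (raise j H) B f → Bounded H B f
    weaken {j} (above , below) = (λ k k≡0 → ℕ.≤-trans (lookup-raise-≥ j H k) (above k k≡0)) , below
    raise₀≤ : ∀ k → 1 ≤ toℕ k → lookup (raise 0 H) k ≤ lookup B k
    raise₀≤ k 1≤k = ≡.subst (_≤ lookup B k) (≡.sym (lookup-raise-≢ H k (ℕ.>⇒≢ 1≤k))) (H≤B k 1≤k)
    raise₀< : ∀ k → suc b ≤ toℕ k → toℕ k < h1 → lookup (raise 0 H) k < lookup B k
    raise₀< k b<k k<h1 = ≡.subst (_< lookup B k) (≡.sym (lookup-raise-≢ H k (ℕ.>⇒≢ (ℕ.≤-trans (s≤s z≤n) b<k))))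
                                 (H<B k (ℕ.<⇒≤ b<k) k<h1)
    raiseᵦ≤ : ∀ k → 1 ≤ toℕ k → lookup (raise b H) k ≤ lookup B k
    raiseᵦ≤ k 1≤k with toℕ k ℕ.≟ b
    ... | yes k≡b = ≡.subst (_≤ lookup B k) (≡.sym (lookup-raise-≡ H k k≡b))
                            (H<B k (ℕ.≤-reflexive (≡.sym k≡b)) (≡.subst (_< h1) (≡.sym k≡b) b<h1))
    ... | no k≢b  = ≡.subst (_≤ lookup B k) (≡.sym (lookup-raise-≢ H k k≢b)) (H≤B k 1≤k)
    raiseᵦ< : ∀ k → suc b ≤ toℕ k → toℕ k < h1 → lookup (raise b H) k < lookup B k
    raiseᵦ< k b<k k<h1 = ≡.subst (_< lookup B k) (≡.sym (lookup-raise-≢ H k (ℕ.>⇒≢ b<k))) (H<B k (ℕ.<⇒≤ b<k) k<h1)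

  record LoweredFrom (b : ℕ) (e G : Exponent) : Set where
    field
      lowered   : ∀ k → b ≤ toℕ k × toℕ k < h1 → suc (lookup G k) ≡ lookup e k
      unlowered : ∀ k → ¬ (b ≤ toℕ k × toℕ k < h1) → lookup G k ≡ lookup e k

    ≤-lowered : ∀ k → lookup G k ≤ lookup e k
    ≤-lowered k with (b ℕ.≤? toℕ k) ×-dec (toℕ k ℕ.<? h1)
    ... | yes inside  = ℕ.≤-trans (ℕ.n≤1+n _) (ℕ.≤-reflexive (lowered k inside))
    ... | no  outside = ℕ.≤-reflexive (unlowered k outside)

    unlowered-below : ∀ k → toℕ k < b → lookup G k ≡ lookup e k
    unlowered-below k k<b = unlowered k (λ (b≤k , _) → ℕ.<-irrefl ≡.refl (ℕ.<-≤-trans k<b b≤k))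
  open LoweredFrom

  lowered-extend : ∀ {j e G} → j < h1 → LoweredFrom (suc j) e (raise j G) → LoweredFrom j e G
  lowered-extend {j} {e} {G} j<h1 low = record { lowered = inside ; unlowered = outside }
    where
    inside : ∀ k → j ≤ toℕ k × toℕ k < h1 → suc (lookup G k) ≡ lookup e k
    inside k (j≤k , k<h1) with toℕ k ℕ.≟ j
    ... | yes k≡j = ≡.trans (≡.sym (lookup-raise-≡ G k k≡j))
                            (unlowered-below low k (ℕ.≤-reflexive (≡.cong suc k≡j)))
    ... | no  k≢j = ≡.trans (≡.cong suc (≡.sym (lookup-raise-≢ G k k≢j)))
                            (lowered low k (ℕ.≤∧≢⇒< j≤k (k≢j ∘ ≡.sym) , k<h1))
    outside : ∀ k → ¬ (j ≤ toℕ k × toℕ k < h1) → lookup G k ≡ lookup e k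
    outside k out = ≡.trans (≡.sym (lookup-raise-≢ G k k≢j))
                            (unlowered low k (λ (j<k , k<h1) → out (ℕ.<⇒≤ j<k , k<h1)))
      where
      k≢j : toℕ k ≢ j
      k≢j k≡j = out (ℕ.≤-reflexive (≡.sym k≡j) , ≡.subst (_< h1) (≡.sym k≡j) j<h1)

  MovesToX₁ : Exponent → Exponent → Set
  MovesToX₁ e f = (∀ k → toℕ k ≡ 0 → lookup e k < lookup f k) × (∀ k → 1 ≤ toℕ k → lookup f k ≤ lookup e k)

  monomial-split : ∀ j G → (∀ k → toℕ k ≡ j → 1 ≤ lookup G k) → monomial G ≈ monomial (lowerBy j 1 G) * x (suc j)
  monomial-split j G G-pos =
    trans (reflexive (≡.cong monomial (≡.sym (raiseBy-lowerBy j 1 G G-pos)))) (sym (monomial*x j (lowerBy j 1 G)))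

  -- x_{j+2} = x₁ - (x₁ - x_{j+2}) moves one more factor x₁ - x_l into the product.
  monomial*differenceProduct-step : ∀ j G → suc j < h1 →
    monomial (raise (suc j) G) * differenceProduct (suc (suc j))
      ≈ monomial (raise 0 G) * differenceProduct (suc (suc j)) - monomial G * differenceProduct (suc j)
  monomial*differenceProduct-step j G j<h1 = begin
    monomial (raise (suc j) G) * D                    ≈⟨ *-congʳ (monomial*x (suc j) G) ⟨
    (monomial G * x b) * D                            ≈⟨ x-[x-y]≈y ((monomial G * x 1) * D) ((monomial G * x b) * D) ⟨
    (monomial G * x 1) * D - ((monomial G * x 1) * D - (monomial G * x b) * D)
                                                      ≈⟨ +-cong (*-congʳ {D} (monomial*x 0 G)) (-‿cong (sym (*-[-]* (monomial G) (x 1) (x b) D))) ⟩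
    monomial (raise 0 G) * D - monomial G * ((x 1 - x b) * D)
                                                      ≡⟨ ≡.cong (λ q → monomial (raise 0 G) * D - monomial G * q) (≡.sym (differenceProduct-∷ j<h1)) ⟩
    monomial (raise 0 G) * D - monomial G * differenceProduct (suc j) ∎
    where
    b = suc (suc j)
    D = differenceProduct b
    open import Algebra.Properties.AbelianGroup +-abelianGroup using (⁻¹-anti-homo‿-; xyx⁻¹≈y)
    x-[x-y]≈y : ∀ u v → u - (u - v) ≈ v
    x-[x-y]≈y u v = trans (+-congˡ (⁻¹-anti-homo‿- u v)) (trans (sym (+-assoc u v (- u))) (xyx⁻¹≈y u v))

  -- At j = 0, x^G still contains x₁, and x₁ ∏_{l=2}^{h1} (x₁ - x_l) ∈ I.
  span-lowered*differenceProduct : ∀ e → (∀ k → toℕ k < h1 → 1 ≤ lookup e k) → ∀ j → j < h1 → ∀ G → LoweredFrom (suc j) e G →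
               Span (MovesToX₁ e) (monomial G * differenceProduct (suc j))
  span-lowered*differenceProduct e e-pos zero 0<h1 G low = span-resp G*D≈0 span-0
    where
    G′ = lowerBy 0 1 G
    G-pos : ∀ k → toℕ k ≡ 0 → 1 ≤ lookup G k
    G-pos k k≡0 = ≡.subst (1 ≤_) (≡.sym (unlowered-below low k (ℕ.≤-reflexive (≡.cong suc k≡0))))
                          (e-pos k (≡.subst (_< h1) (≡.sym k≡0) 0<h1))
    G*D≈0 : monomial G * differenceProduct 1 ≈ 0P
    G*D≈0 = begin
      monomial G * differenceProduct 1          ≈⟨ *-congʳ (monomial-split 0 G G-pos) ⟩
      (monomial G′ * x 1) * differenceProduct 1 ≈⟨ *-assoc (monomial G′) (x 1) (differenceProduct 1) ⟩
      monomial G′ * (x 1 * differenceProduct 1) ≈⟨ *-congˡ {monomial G′} x₁*differenceProduct≈0 ⟩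
      monomial G′ * 0P                          ≈⟨ zeroʳ (monomial G′) ⟩
      0P ∎
  span-lowered*differenceProduct e e-pos (suc j) j<h1 G low = span-resp expand
    (span-+ (span-mono (λ {f} → moves {f}) (span-monomial*differenceProduct (h1 ∸ b) b (raise 0 G″) e (ℕ.m∸n+n≡m j<h1) below within))
            (span-neg (span-lowered*differenceProduct e e-pos j (ℕ.<⇒≤ j<h1) G″ (lowered-extend j<h1 low″))))
    where
    b = suc (suc j)
    G″ = lowerBy (suc j) 1 G
    G≡ : raise (suc j) G″ ≡ G
    G≡ = raiseBy-lowerBy (suc j) 1 G (λ k k≡j → ≡.subst (1 ≤_) (≡.sym (unlowered-below low k (ℕ.≤-reflexive (≡.cong suc k≡j))))
                                                      (e-pos k (≡.subst (_< h1) (≡.sym k≡j) j<h1)))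
    low″ : LoweredFrom b e (raise (suc j) G″)
    low″ = ≡.subst (LoweredFrom b e) (≡.sym G≡) low
    G″≡ : ∀ k → toℕ k ≢ suc j → lookup G″ k ≡ lookup G k
    G″≡ k k≢j = ≡.trans (≡.sym (lookup-raise-≢ G″ k k≢j)) (≡.cong (λ v → lookup v k) G≡)
    expand : monomial G * differenceProduct b ≈ monomial (raise 0 G″) * differenceProduct b - monomial G″ * differenceProduct (suc j)
    expand = trans (*-congʳ (reflexive (≡.cong monomial (≡.sym G≡)))) (monomial*differenceProduct-step j G″ j<h1)
    below : ∀ k → 1 ≤ toℕ k → lookup (raise 0 G″) k ≤ lookup e k
    below k 1≤k = ℕ.≤-trans (ℕ.≤-reflexive (lookup-raise-≢ G″ k (ℕ.>⇒≢ 1≤k)))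
      (ℕ.≤-trans (lookup-raise-≥ (suc j) G″ k) (ℕ.≤-trans (ℕ.≤-reflexive (≡.cong (λ v → lookup v k) G≡)) (≤-lowered low k)))
    within : ∀ k → b ≤ toℕ k → toℕ k < h1 → lookup (raise 0 G″) k < lookup e k
    within k b≤k k<h1 = ℕ.≤-reflexive (≡.trans (≡.cong suc (≡.trans (lookup-raise-≢ G″ k (ℕ.>⇒≢ (ℕ.≤-trans (s≤s z≤n) b≤k)))
      (G″≡ k (ℕ.>⇒≢ b≤k)))) (lowered low k (b≤k , k<h1)))
    moves : ∀ {f} → Bounded (raise 0 G″) e f → MovesToX₁ e f
    moves (above , below) = (λ k k≡0 → ℕ.≤-trans (ℕ.≤-reflexive (≡.cong suc (≡.trans
      (≡.sym (unlowered-below low k (≡.subst (_< b) (≡.sym k≡0) (s≤s z≤n))))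
      (≡.sym (G″≡ k (λ k≡j → ℕ.1+n≢0 (≡.trans (≡.sym k≡j) k≡0)))))))
      (ℕ.≤-trans (ℕ.≤-reflexive (≡.sym (lookup-raise-≡ G″ k k≡0))) (above k k≡0))) , below

  BoxAbove : ℕ → Exponent → Set
  BoxAbove j e = ∀ k → j ≤ toℕ k → lookup e k ≤ n ∸ suc (toℕ k)

  box-descent : ∀ {j} → j < n → ∀ {e} → BoxAbove (suc j) e → Span (BoxAbove j) (monomial e)
  box-descent {j} j<n = span-descent (λ e → lookup e kⱼ) step
    where
    kⱼ : Fin n
    kⱼ = Fin.fromℕ< j<n
    ≡kⱼ : ∀ {k} → toℕ k ≡ j → k ≡ kⱼ
    ≡kⱼ k≡j = Fin.toℕ-injective (≡.trans k≡j (≡.sym (Fin.toℕ-fromℕ< j<n)))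
    step : ∀ {e} → BoxAbove (suc j) e →
           Span (λ f → BoxAbove j f ⊎ (BoxAbove (suc j) f × lookup f kⱼ < lookup e kⱼ)) (monomial e)
    step {e} box = by-cases (lookup e kⱼ ℕ.≤? n ∸ suc j)
      where
      by-cases : Dec (lookup e kⱼ ≤ n ∸ suc j) →
                 Span (λ f → BoxAbove j f ⊎ (BoxAbove (suc j) f × lookup f kⱼ < lookup e kⱼ)) (monomial e)
      by-cases (yes small) = span-monomial (inj₁ box′)
        where
        box′ : BoxAbove j e
        box′ k j≤k with toℕ k ℕ.≟ j
        ... | yes k≡j = ≡.subst (λ k′ → lookup e k′ ≤ n ∸ suc (toℕ k′)) (≡.sym (≡kⱼ k≡j))
                          (≡.subst (λ i → lookup e kⱼ ≤ n ∸ suc i) (≡.sym (Fin.toℕ-fromℕ< j<n)) small)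
        ... | no  k≢j = box k (ℕ.≤∧≢⇒< j≤k (k≢j ∘ ≡.sym))
      by-cases (no big) = span-mono (λ (drops , agree) → inj₂ ((λ k j<k → ℕ.≤-trans (ℕ.≤-reflexive (agree k j<k)) (box k j<k)) ,
                                                         drops kⱼ (Fin.toℕ-fromℕ< j<n)))
                                    (span-drop j<n e big′)
        where
        big′ : ∀ k → toℕ k ≡ j → n ∸ j ≤ lookup e k
        big′ k k≡j = ≡.subst (λ k′ → n ∸ j ≤ lookup e k′) (≡.sym (≡kⱼ k≡j))
                             (≡.subst (_≤ lookup e kⱼ) (≡.sym (∸-suc j<n)) (ℕ.≰⇒> big))

  module _ (0<n : 0 < n) (0<h1 : 0 < h1) where

    k₀ : Fin n
    k₀ = Fin.fromℕ< 0<n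

    ≡k₀ : ∀ {k} → toℕ k ≡ 0 → k ≡ k₀
    ≡k₀ k≡0 = Fin.toℕ-injective (≡.trans k≡0 (≡.sym (Fin.toℕ-fromℕ< 0<n)))

    monomial≈monomial*differenceProduct : ∀ e → monomial e ≈ monomial e * differenceProduct h1
    monomial≈monomial*differenceProduct e = sym (trans (*-congˡ {monomial e} (reflexive differenceProduct-[])) (*-identityʳ _))

    span-divisible : ∀ {e} → MonDvd prodFirst e → Span (MovesToX₁ e) (monomial e)
    span-divisible {e} dvd = span-resp (monomial≈monomial*differenceProduct e)
      (≡.subst (λ b → Span (MovesToX₁ e) (monomial e * differenceProduct b)) h1-1+1≡h1
        (span-lowered*differenceProduct e e-pos (h1 ∸ 1) (ℕ.≤-reflexive h1-1+1≡h1) e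
          (≡.subst (λ b → LoweredFrom b e e) (≡.sym h1-1+1≡h1) unchanged)))
      where
      h1-1+1≡h1 : suc (h1 ∸ 1) ≡ h1
      h1-1+1≡h1 = ℕ.m+[n∸m]≡n 0<h1
      e-pos : ∀ k → toℕ k < h1 → 1 ≤ lookup e k
      e-pos k k<h1 = ≡.subst (_≤ lookup e k) (≡.trans (Vec.lookup∘tabulate _ k) (Bool.if-cong (Equivalence.to Bool.T-≡ (ℕ.<⇒<ᵇ k<h1)))) (dvd k)
      unchanged : LoweredFrom h1 e e
      unchanged = record { lowered = λ k (h1≤k , k<h1) → ⊥-elim (ℕ.<-irrefl ≡.refl (ℕ.<-≤-trans k<h1 h1≤k))
                         ; unlowered = λ _ _ → ≡.refl }

    x₁-descent : ∀ {e} → BoxAbove 1 e → Span InB1 (monomial e)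
    x₁-descent = span-descent (λ e → n ∸ lookup e k₀) step
      where
      step : ∀ {e} → BoxAbove 1 e → Span (λ f → InB1 f ⊎ (BoxAbove 1 f × n ∸ lookup f k₀ < n ∸ lookup e k₀)) (monomial e)
      step {e} box = by-cases (n ℕ.≤? lookup e k₀) (Fin.all? (λ k → lookup prodFirst k ℕ.≤? lookup e k))
        where
        by-cases : Dec (n ≤ lookup e k₀) → Dec (MonDvd prodFirst e) →
                   Span (λ f → InB1 f ⊎ (BoxAbove 1 f × n ∸ lookup f k₀ < n ∸ lookup e k₀)) (monomial e)
        by-cases (yes big) _ = span-resp (x₁-power-vanishes 0<n e (λ k k≡0 → ≡.subst (λ k′ → n ≤ lookup e k′) (≡.sym (≡k₀ k≡0)) big)) span-0
        by-cases (no small) (no ¬dvd) = span-monomial (inj₁ (bounded , ¬dvd))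
          where
          bounded : ∀ k → lookup e k ≤ n ∸ suc (toℕ k)
          bounded k with toℕ k ℕ.≟ 0
          ... | yes k≡0 = ≡.subst (λ k′ → lookup e k′ ≤ n ∸ suc (toℕ k′)) (≡.sym (≡k₀ k≡0))
                            (≡.subst (λ i → lookup e k₀ ≤ n ∸ suc i) (≡.sym (Fin.toℕ-fromℕ< 0<n)) (ℕ.∸-monoˡ-≤ 1 (ℕ.≰⇒> small)))
          ... | no  k≢0 = box k (ℕ.n≢0⇒n>0 k≢0)
        by-cases (no small) (yes dvd) = span-mono (λ (above , below) → inj₂
          ( (λ k 1≤k → ℕ.≤-trans (below k 1≤k) (box k 1≤k))
          , ℕ.≤-<-trans (ℕ.∸-monoʳ-≤ n (above k₀ (Fin.toℕ-fromℕ< 0<n)))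
                        (ℕ.∸-monoʳ-< (ℕ.n<1+n (lookup e k₀)) (ℕ.≰⇒> small))))
          (span-divisible dvd)

    span-B1 : ∀ j → 1 ≤ j → j ≤ n → ∀ {e} → BoxAbove j e → Span InB1 (monomial e)
    span-B1 (suc zero)    _ _   = x₁-descent
    span-B1 (suc (suc j)) _ j<n = span-bind (span-B1 (suc j) (s≤s z≤n) (ℕ.<⇒≤ j<n)) ∘ box-descent j<n

    span-B1-all : ∀ (f : PolX) → Span InB1 (liftX f)
    span-B1-all f = span-bind (span-B1 n 0<n ℕ.≤-refl)
      (f , All.universal (λ _ k n≤k → ⊥-elim (ℕ.<-irrefl ≡.refl (ℕ.<-≤-trans (Fin.toℕ<n k) n≤k))) f , refl)

    reduce-to-B1 : ∀ (f : PolX) → ∃ λ (cs : PolX) → All (λ t → InB1 (proj₂ t)) cs × (liftX f ≡I liftX cs)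
    reduce-to-B1 f = let (cs , cs∈B1 , f∼cs) = span-B1-all f in cs , cs∈B1 , difference∈I f∼cs

-- Every polynomial reduces.
mainTheorem8 : {c ℓ : Level} (K : Field c ℓ) → CharZero K →
    (n h1 : ℕ) → 2 ≤ n → 1 ≤ h1 → h1 ≤ n →
    let open Setup K n h1 in
    (f : PolX) → Homogeneous f →
    ∃ λ (cs : PolX) → All (λ t → InB1 (proj₂ t)) cs × (liftX f ≡I liftX cs)
mainTheorem8 K _ n h1 2≤n 1≤h1 _ f _ = Reduction.reduce-to-B1 K n h1 (ℕ.≤-trans (s≤s z≤n) 2≤n) 1≤h1 f
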